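{- Let $\mu$ be a partition and let $x\in K_\mu$ with $|S(x)|=w(\mu)$. Then $S(x)\cap t(S(x))=\emptyset$.
   Context: Partitions: $l(\mu)$ number of nonzero parts, $|\mu|$ sum of parts, $w(\mu)=l(\mu)+|\mu|$. $S_{2\infty}$ is the group of finitely supported permutations of the positive integers, $S(x)=\{i:x(i)\ne i\}$, and $t$ is the partner map $t(2i-1)=2i$, $t(2i)=2i-1$. For $x\in S_{2n}$ the graph $\Gamma_x$ has vertices $v_i=(i,x(i))$, $i\in[2n]$, straight edges $(v_{2i-1}:v_{2i})$ and curved edges $(v_{x^{ -1}(2i-1)}:v_{x^{ -1}(2i)})$, $i=1,\dots,n$; if its connected components have sizes $2s_1\ge\dots\ge2s_k$, the stable coset type $\mu_x$ is the partition with parts $s_j-1$ (zeros discarded), independent of $n$. $K_\mu=\{x\in S_{2\infty}:\mu_x=\mu\}$. -}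

module Defs where

open import Data.Nat using (ℕ; zero; suc; _+_; _*_; _∸_; _/_; _≡ᵇ_)
open import Data.Nat.Properties using (≤-decTotalOrder)
open import Data.Bool using (Bool; true; false; _∧_; _∨_; not; if_then_else_)
open import Data.Fin using (Fin; zero; suc; toℕ; _≟_)
open import Data.Fin.Permutation using (Permutation′; _⟨$⟩ʳ_; _⟨$⟩ˡ_)
open import Data.List using (List; []; _∷_; filter; length; map; allFin; reverse)
open import Data.Nat.ListAction using (sum)
import Data.List.Sort.InsertionSort.Base
open import Relation.Nullary using (¬_; does)
open import Relation.Unary using (Pred)
open import Relation.Binary.PropositionalEquality using (_≡_)
open import Data.List.Relation.Unary.All using (All)
open import Relation.Nullary.Decidable using (⌊_⌋)

-- Vertices are indexed 0-based by Fin m: index k corresponds to the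
-- positive integer k+1 of the paper.

-- Partner map t (0-based: 0↔1, 2↔3, ...; corresponds to 2i-1 ↔ 2i).
-- Only used for even m = 2n (the last point of an odd m is fixed).
t : ∀ {m} → Fin m → Fin m
t {suc zero} zero = zero
t {suc (suc m)} zero = suc zero
t {suc (suc m)} (suc zero) = zero
t {suc (suc m)} (suc (suc i)) = suc (suc (t i))

_==_ : ∀ {m} → Fin m → Fin m → Bool
i == j = does (i ≟ j)

anyFin : ∀ {m} → (Fin m → Bool) → Bool
anyFin {m} p = Data.List.foldr (λ i b → p i ∨ b) false (allFin m)

countFin : ∀ {m} → (Fin m → Bool) → ℕ
countFin {m} p = length (filter (λ i → p i Data.Bool.≟ true) (allFin m))

module _ (n : ℕ) (x : Permutation′ (2 * n)) where

  -- Adjacency in Γ_x (vertex v_i identified with index i):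
  -- straight edge (v_i : v_{t i});
  -- curved edge (v_{x⁻¹(a)} : v_{x⁻¹(t a)}), i.e. j ~ k iff x k = t (x j).
  adj : Fin (2 * n) → Fin (2 * n) → Bool
  adj j k = (k == t j) ∨ ((x ⟨$⟩ʳ k) == t (x ⟨$⟩ʳ j))

  reachN : ℕ → Fin (2 * n) → Fin (2 * n) → Bool
  reachN zero i j = i == j
  reachN (suc r) i j = reachN r i j ∨ anyFin (λ l → reachN r i l ∧ adj l j)

  -- connectivity in Γ_x (paths of length < 2n suffice)
  reach : Fin (2 * n) → Fin (2 * n) → Bool
  reach = reachN (2 * n)

  compSize : Fin (2 * n) → ℕ
  compSize i = countFin (reach i)

  isRep : Fin (2 * n) → Bool
  isRep i = not (anyFin (λ j → reach i j ∧ ⌊ toℕ j Data.Nat.<? toℕ i ⌋))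

  -- stable coset type μ_x: parts s_j - 1 (components of size 2 s_j),
  -- zeros discarded, listed in weakly decreasing order
  cosetType : List ℕ
  cosetType =
    reverse (Data.List.Sort.InsertionSort.Base.sort ≤-decTotalOrder
      (filter (λ s → Relation.Nullary.¬? (Data.Nat._≟_ s 0))
        (map (λ i → compSize i / 2 ∸ 1) (filter (λ i → isRep i Data.Bool.≟ true) (allFin (2 * n))))))

  inS : Fin (2 * n) → Set
  inS i = ¬ (x ⟨$⟩ʳ i ≡ i)

  sizeS : ℕ
  sizeS = countFin (λ i → not ((x ⟨$⟩ʳ i) == i))

lenP : List ℕ → ℕ
lenP μ = length (filter (λ s → Relation.Nullary.¬? (Data.Nat._≟_ s 0)) μ)

sizeP : List ℕ → ℕ
sizeP = sum

w : List ℕ → ℕ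
w μ = lenP μ + sizeP μ

module Submission where

-- We prove the sharper inequality |S(x)| > w(μ_x) whenever both i and t i lie in S(x),
-- by double counting.  Call a vertex v of Γ_x covered if its component has more than two
-- vertices, and let coverage v ∈ {0, 1} record this.
--   * Summing over components: a component with 2s vertices contributes the part s - 1 to
--     μ_x, of weight w[s - 1] = s for s ≥ 2 and 0 otherwise, so 2 w(μ_x) ≤ Σ_v coverage v.
--   * Summing over vertices: if v and t v are both fixed by x, then {v, t v} is a whole
--     component of size two, so coverage v ≤ [v ∈ S] + [t v ∈ S]; at v = i and v = t i the
--     right-hand side is 2, leaving one extra unit each.  Since t permutes the vertices,
--     Σ_v coverage v + 2 ≤ 2 |S(x)|.

open import Defs
open import Data.Nat using (ℕ; zero; suc; _+_; _*_; _∸_; _/_; _≤_; _<_; _<ᵇ_; _<?_; z≤n; s≤s)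
  renaming (_≟_ to _≟ℕ_)
open import Data.Nat.Properties
  using (≤-refl; ≤-reflexive; ≤-trans; ≤-antisym; <-irrefl; ≮⇒≥; ≰⇒>; <⇒≱; <ᵇ⇒<; m≤n⇒m≤1+n; n≤1+n;
         +-mono-≤; +-monoˡ-≤; m≤n+m; m≤m+n; m+1+n≰m; m∸n+n≡m; +-identityʳ; +-suc; +-comm; +-assoc;
         *-suc; even≢odd; +-0-commutativeMonoid; ≤-decTotalOrder; module ≤-Reasoning)
open import Data.Nat.DivMod using (m/n*n≤m)
open import Data.Nat.Tactic.RingSolver using (solve-∀)
open import Data.Nat.ListAction using (sum)
open import Data.Nat.ListAction.Properties using (sum-↭)
open import Data.Bool using (Bool; true; false; _∧_; _∨_; not; if_then_else_; T) renaming (_≟_ to _≟ᵇ_)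
open import Data.Bool.Properties using (T-∧; T-∨)
open import Data.Fin using (Fin; zero; suc; toℕ; _≟_)
open import Data.Fin.Properties using (suc-injective; toℕ-injective; all?; any?; ¬∀⟶∃¬)
open import Data.Fin.Permutation using (Permutation′; permutation; _⟨$⟩ʳ_; _⟨$⟩ˡ_; inverseˡ)
open import Data.List using (List; []; _∷_; filter; length; map; allFin; tabulate; foldr)
open import Data.List.Properties using (map-∘)
open import Data.List.Membership.Propositional using (_∈_)
open import Data.List.Membership.Propositional.Properties using (∈-allFin)
open import Data.List.Relation.Unary.Any using (here; there)
open import Data.List.Relation.Binary.Permutation.Propositional using (_↭_; ↭-trans)
open import Data.List.Relation.Binary.Permutation.Propositional.Properties using (↭-reverse; filter-↭; ↭-length)
open import Data.List.Sort.InsertionSort.Properties using (sort-↭)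
open import Data.Product using (_×_; _,_; ∃; proj₁; proj₂)
open import Data.Sum using (_⊎_; inj₁; inj₂)
open import Data.Empty using (⊥; ⊥-elim)
open import Data.Unit using (tt)
open import Function using (_∘_)
open import Function.Bundles using (Equivalence)
open import Relation.Nullary using (¬_; Dec; yes; no; ¬?)
open import Relation.Nullary.Decidable using (⌊_⌋; fromWitness; T?; _→-dec_)
open import Relation.Binary.PropositionalEquality
open import Algebra.Properties.CommutativeMonoid.Sum +-0-commutativeMonoid
  using (∑-distrib-+; ∑-comm; ∑-permute; sum-replicate-zero)
  renaming (sum to ∑)

open Equivalence using (to; from)

==⇒≡ : ∀ {m} {i j : Fin m} → T (i == j) → i ≡ j
==⇒≡ {i = i} {j} h with i ≟ j
... | yes i≡j = i≡j

≡⇒== : ∀ {m} {i j : Fin m} → i ≡ j → T (i == j)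
≡⇒== {i = i} {j} i≡j with i ≟ j
... | yes _ = tt
... | no i≢j = i≢j i≡j

≢⇒false : ∀ {m} {i j : Fin m} → ¬ i ≡ j → (i == j) ≡ false
≢⇒false {i = i} {j} i≢j with i ≟ j
... | yes i≡j = ⊥-elim (i≢j i≡j)
... | no _ = refl

any-intro : ∀ {m} (p : Fin m → Bool) {j} → T (p j) → T (anyFin p)
any-intro {m} p {j} pj = go (allFin m) (∈-allFin j)
  where
  go : ∀ xs → j ∈ xs → T (foldr (λ i b → p i ∨ b) false xs)
  go (x ∷ xs) (here refl) = from T-∨ (inj₁ pj)
  go (x ∷ xs) (there j∈xs) = from T-∨ (inj₂ (go xs j∈xs))

any-elim : ∀ {m} (p : Fin m → Bool) → T (anyFin p) → ∃ λ j → T (p j)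
any-elim {m} p = go (allFin m)
  where
  go : ∀ xs → T (foldr (λ i b → p i ∨ b) false xs) → ∃ λ j → T (p j)
  go (x ∷ xs) h with to T-∨ h
  ... | inj₁ px = x , px
  ... | inj₂ rest = go xs rest

any-cong : ∀ {m} {p q : Fin m → Bool} → (∀ i → p i ≡ q i) → anyFin p ≡ anyFin q
any-cong {m} {p} {q} p≗q = go (allFin m)
  where
  go : ∀ xs → foldr (λ i b → p i ∨ b) false xs ≡ foldr (λ i b → q i ∨ b) false xs
  go [] = refl
  go (x ∷ xs) = cong₂ _∨_ (p≗q x) (go xs)

ind : Bool → ℕ
ind b = if b then 1 else 0

count : ∀ {m} → (Fin m → Bool) → ℕ
count p = ∑ (ind ∘ p)

ind-pos : ∀ {b} → T b → 1 ≤ ind b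
ind-pos {true} _ = ≤-refl

ind-≤1 : ∀ b → ind b ≤ 1
ind-≤1 true = ≤-refl
ind-≤1 false = z≤n

counterexample : ∀ b {B : Set} → ¬ (T b → B) → T b × ¬ B
counterexample true ¬b⇒B = tt , λ B → ¬b⇒B λ _ → B
counterexample false ¬b⇒B = ⊥-elim (¬b⇒B λ ())

∑-mono : ∀ {m} {f g : Fin m → ℕ} → (∀ j → f j ≤ g j) → ∑ f ≤ ∑ g
∑-mono {zero} _ = z≤n
∑-mono {suc m} f≤g = +-mono-≤ (f≤g zero) (∑-mono (f≤g ∘ suc))

count-mono : ∀ {m} {p q : Fin m → Bool} → (∀ j → T (p j) → T (q j)) → count p ≤ count q
count-mono {p = p} {q} p⊆q = ∑-mono λ j → mono (p j) (q j) (p⊆q j)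
  where
  mono : ∀ b c → (T b → T c) → ind b ≤ ind c
  mono false c _ = z≤n
  mono true c b⇒c = ind-pos (b⇒c tt)

count-cover : ∀ {m} {p q r : Fin m → Bool} → (∀ j → T (p j) → T (q j) ⊎ T (r j)) →
  count p ≤ count q + count r
count-cover {p = p} {q} {r} cover =
  ≤-trans (∑-mono λ j → ind-cover (p j) (q j) (r j) (cover j)) (≤-reflexive (∑-distrib-+ (ind ∘ q) (ind ∘ r)))
  where
  ind-cover : ∀ b c d → (T b → T c ⊎ T d) → ind b ≤ ind c + ind d
  ind-cover false c d _ = z≤n
  ind-cover true c d b⇒c∨d with b⇒c∨d tt
  ... | inj₁ tc = ≤-trans (ind-pos tc) (m≤m+n (ind c) (ind d))
  ... | inj₂ td = ≤-trans (ind-pos td) (m≤n+m (ind d) (ind c))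

count-disjoint : ∀ {m} {p q r : Fin m → Bool} → (∀ j → T (p j) → T (r j)) → (∀ j → T (q j) → T (r j)) →
  (∀ j → T (p j) → ¬ T (q j)) → count p + count q ≤ count r
count-disjoint {p = p} {q} {r} p⊆r q⊆r disjoint =
  ≤-trans (≤-reflexive (sym (∑-distrib-+ (ind ∘ p) (ind ∘ q))))
    (∑-mono λ j → ind-disjoint (p j) (q j) (r j) (p⊆r j) (q⊆r j) (disjoint j))
  where
  ind-disjoint : ∀ b c d → (T b → T d) → (T c → T d) → (T b → ¬ T c) → ind b + ind c ≤ ind d
  ind-disjoint false false d _ _ _ = z≤n
  ind-disjoint true true d _ _ b#c = ⊥-elim (b#c tt tt)
  ind-disjoint true false d b⇒d _ _ = ind-pos (b⇒d tt)
  ind-disjoint false true d _ c⇒d _ = ind-pos (c⇒d tt)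

count-≤ : ∀ {m} (p : Fin m → Bool) → count p ≤ m
count-≤ {zero} p = z≤n
count-≤ {suc m} p = +-mono-≤ (ind-≤1 (p zero)) (count-≤ (p ∘ suc))

count-singleton : ∀ {m} (i : Fin m) → count (_== i) ≡ 1
count-singleton {suc m} zero = cong suc (sum-replicate-zero m)
count-singleton {suc m} (suc i) = count-singleton i

count-unique : ∀ {m} (p : Fin m → Bool) → (∀ a b → T (p a) → T (p b) → a ≡ b) → count p ≤ 1
count-unique {m} p unique with any? (T? ∘ p)
... | yes (a , pa) = ≤-trans (count-mono λ j pj → ≡⇒== (unique j a pj pa)) (≤-reflexive (count-singleton a))
... | no ¬∃ = begin
  count p                ≤⟨ count-mono {q = λ _ → false} (λ j pj → ¬∃ (j , pj)) ⟩
  count {m} (λ _ → false) ≡⟨ sum-replicate-zero m ⟩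
  0                      ≤⟨ z≤n ⟩
  1                      ∎
  where open ≤-Reasoning

sum-filter-tabulate : ∀ {m} {A : Set} (p : A → Bool) (F : A → ℕ) (f : Fin m → A) →
  sum (map F (filter (λ a → p a ≟ᵇ true) (tabulate f))) ≡ ∑ (λ j → if p (f j) then F (f j) else 0)
sum-filter-tabulate {zero} p F f = refl
sum-filter-tabulate {suc m} p F f with p (f zero)
... | true = cong (F (f zero) +_) (sum-filter-tabulate p F (f ∘ suc))
... | false = sum-filter-tabulate p F (f ∘ suc)

countFin≡count : ∀ {m} (p : Fin m → Bool) → countFin p ≡ count p
countFin≡count {m} p = trans (length≡sum (filter (λ i → p i ≟ᵇ true) (allFin m))) (sum-filter-tabulate p (λ _ → 1) (λ i → i))
  where
  length≡sum : ∀ {A : Set} (xs : List A) → length xs ≡ sum (map (λ _ → 1) xs)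
  length≡sum [] = refl
  length≡sum (_ ∷ xs) = cong suc (length≡sum xs)

t-invol : ∀ {m} (i : Fin m) → t (t i) ≡ i
t-invol {suc zero} zero = refl
t-invol {suc (suc m)} zero = refl
t-invol {suc (suc m)} (suc zero) = refl
t-invol {suc (suc m)} (suc (suc i)) = cong (λ j → suc (suc j)) (t-invol i)

t-swap : ∀ {m} {a b : Fin m} → a ≡ t b → b ≡ t a
t-swap {b = b} a≡tb = trans (sym (t-invol b)) (cong t (sym a≡tb))

t-permutation : ∀ {m} → Permutation′ m
t-permutation = permutation t t t-invol t-invol

∑-t : ∀ {m} (f : Fin m → ℕ) → ∑ (f ∘ t) ≡ ∑ f
∑-t f = sym (∑-permute f t-permutation)

t-fixed : ∀ {m} (i : Fin m) → t i ≡ i → ∃ λ k → m ≡ suc (2 * k)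
t-fixed {suc zero} zero _ = 0 , refl
t-fixed {suc (suc m)} (suc (suc i)) ti≡i with t-fixed i (suc-injective (suc-injective ti≡i))
... | k , m≡2k+1 = suc k , trans (cong (λ j → suc (suc j)) m≡2k+1) (cong suc (sym (*-suc 2 k)))

t-no-fixed-point : ∀ n (i : Fin (2 * n)) → ¬ t i ≡ i
t-no-fixed-point n i ti≡i with t-fixed i ti≡i
... | k , 2n≡2k+1 = even≢odd n k 2n≡2k+1

module BoundedWalks {m : ℕ} (A : Fin m → Fin m → Bool) where

  walk : ℕ → Fin m → Fin m → Bool
  walk zero i j = i == j
  walk (suc r) i j = walk r i j ∨ anyFin (λ l → walk r i l ∧ A l j)

  -- The same fact as a proposition whose indices Agda can infer.
  record Walk (r : ℕ) (i j : Fin m) : Set where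
    constructor walked
    field holds : T (walk r i j)
  open Walk public

  Edge : Fin m → Fin m → Set
  Edge l j = T (A l j)

  walk-refl : ∀ r {i} → Walk r i i
  walk-refl zero {i} = walked (≡⇒== {i = i} refl)
  walk-refl (suc r) = walked (from T-∨ (inj₁ (holds (walk-refl r))))

  walk-suc : ∀ {r i j} → Walk r i j → Walk (suc r) i j
  walk-suc w = walked (from T-∨ (inj₁ (holds w)))

  walk-snoc : ∀ {r i l j} → Walk r i l → Edge l j → Walk (suc r) i j
  walk-snoc {r} {i} {l} {j} w e =
    walked (from T-∨ (inj₂ (any-intro (λ k → walk r i k ∧ A k j) (from T-∧ (holds w , e)))))

  walk-zero : ∀ {i j} → Walk 0 i j → i ≡ j
  walk-zero w = ==⇒≡ (holds w)

  walk-last : ∀ {r i j} → Walk (suc r) i j → Walk r i j ⊎ ∃ λ l → Walk r i l × Edge l j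
  walk-last {r} {i} {j} w with to T-∨ (holds w)
  ... | inj₁ w′ = inj₁ (walked w′)
  ... | inj₂ ex with any-elim (λ k → walk r i k ∧ A k j) ex
  ... | l , w∧e with to T-∧ w∧e
  ... | w′ , e = inj₂ (l , walked w′ , e)

  walk-weaken : ∀ d {r i j} → Walk r i j → Walk (d + r) i j
  walk-weaken zero w = w
  walk-weaken (suc d) w = walk-suc (walk-weaken d w)

  walk-append : ∀ a b {i j k} → Walk a i j → Walk b j k → Walk (a + b) i k
  walk-append a zero {i} w₁ w₂ = subst₂ (λ r k → Walk r i k) (sym (+-identityʳ a)) (walk-zero w₂) w₁
  walk-append a (suc b) w₁ w₂ rewrite +-suc a b with walk-last w₂
  ... | inj₁ w₂′ = walk-suc (walk-append a b w₁ w₂′)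
  ... | inj₂ (l , w₂′ , e) = walk-snoc (walk-append a b w₁ w₂′) e

  walk-reverse : (∀ {l j} → Edge l j → Edge j l) → ∀ r {i j} → Walk r i j → Walk r j i
  walk-reverse A-sym zero w = subst (λ k → Walk 0 k _) (walk-zero w) (walk-refl 0)
  walk-reverse A-sym (suc r) w with walk-last w
  ... | inj₁ w′ = walk-suc (walk-reverse A-sym r w′)
  ... | inj₂ (l , w′ , e) = walk-append 1 r (walk-snoc (walk-refl 0) (A-sym e)) (walk-reverse A-sym r w′)

  walk-invariant : (P : Fin m → Set) → (∀ {l j} → P l → Edge l j → P j) →
    ∀ r {i j} → P i → Walk r i j → P j
  walk-invariant P step zero Pi w = subst P (walk-zero w) Pi
  walk-invariant P step (suc r) Pi w with walk-last w
  ... | inj₁ w′ = walk-invariant P step r Pi w′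
  ... | inj₂ (l , w′ , e) = step (walk-invariant P step r Pi w′) e

  -- Saturation: the set reached from i grows strictly until it stops growing for good,
  -- and it has at most m points, so walks of length m already reach everything.
  reached : Fin m → ℕ → ℕ
  reached i r = count (walk r i)

  Stable : Fin m → ℕ → Set
  Stable i r = ∀ {j} → Walk (suc r) i j → Walk r i j

  stable-forever : ∀ {i r} → Stable i r → ∀ d {j} → Walk (d + r) i j → Walk r i j
  stable-forever st zero w = w
  stable-forever st (suc d) w with walk-last w
  ... | inj₁ w′ = stable-forever st d w′
  ... | inj₂ (l , w′ , e) = st (walk-snoc (stable-forever st d w′) e)

  grows-at : ∀ {i r j} → Walk (suc r) i j → ¬ Walk r i j → suc (reached i r) ≤ reached i (suc r)
  grows-at {i} {r} {j} new ¬old = begin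
    suc (reached i r)              ≡⟨ +-comm 1 (reached i r) ⟩
    reached i r + 1                ≡⟨ cong (reached i r +_) (count-singleton j) ⟨
    reached i r + count (_== j)    ≤⟨ count-disjoint {p = walk r i} {q = _== j} {r = walk (suc r) i}
                                        (λ k old → holds (walk-suc {r} {i} {k} (walked old)))
                                        (λ k k≡j → subst (T ∘ walk (suc r) i) (sym (==⇒≡ k≡j)) (holds new))
                                        (λ k old k≡j → ¬old (walked (subst (T ∘ walk r i) (==⇒≡ k≡j) old))) ⟩
    reached i (suc r)              ∎
    where open ≤-Reasoning

  persists? : ∀ i r j → Dec (T (walk (suc r) i j) → T (walk r i j))
  persists? i r j = T? (walk (suc r) i j) →-dec T? (walk r i j)

  stable-or-grows : ∀ i r → Stable i r ⊎ suc (reached i r) ≤ reached i (suc r)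
  stable-or-grows i r with all? (persists? i r)
  ... | yes st = inj₁ λ w → walked (st _ (holds w))
  ... | no ¬st with ¬∀⟶∃¬ m _ (persists? i r) ¬st
  ... | j , ¬persists with counterexample (walk (suc r) i j) ¬persists
  ... | new , ¬old = inj₂ (grows-at (walked new) λ old → ¬old (holds {r} {i} {j} old))

  eventually-stable : ∀ i r → (∃ λ s → s ≤ r × Stable i s) ⊎ suc r ≤ reached i r
  eventually-stable i zero =
    inj₂ (≤-trans (≤-reflexive (sym (count-singleton i)))
      (count-mono {p = _== i} {q = walk 0 i} λ j j≡i → ≡⇒== (sym (==⇒≡ {i = j} j≡i))))
  eventually-stable i (suc r) with eventually-stable i r
  ... | inj₁ (s , s≤r , st) = inj₁ (s , m≤n⇒m≤1+n s≤r , st)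
  ... | inj₂ grown with stable-or-grows i r
  ... | inj₁ st = inj₁ (r , n≤1+n r , st)
  ... | inj₂ grows = inj₂ (≤-trans (s≤s grown) grows)

  saturate : ∀ r {i j} → Walk r i j → Walk m i j
  saturate r {i} {j} w with eventually-stable i m
  ... | inj₂ too-many = ⊥-elim (<-irrefl refl (≤-trans too-many (count-≤ (walk m i))))
  ... | inj₁ (s , s≤m , st) =
    subst (λ k → Walk k i j) (m∸n+n≡m s≤m)
      (walk-weaken (m ∸ s) (stable-forever st r (subst (λ k → Walk k i j) (+-comm s r) (walk-weaken s w))))

  Connected : Fin m → Fin m → Set
  Connected = Walk m

  connected-sym : (∀ {l j} → Edge l j → Edge j l) → ∀ {i j} → Connected i j → Connected j i
  connected-sym A-sym = walk-reverse A-sym m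

  connected-trans : ∀ {i j k} → Connected i j → Connected j k → Connected i k
  connected-trans w₁ w₂ = saturate (m + m) (walk-append m m w₁ w₂)

-- The weight w[k] = l[k] + k of a partition with the single part k.
partWeight : ℕ → ℕ
partWeight zero = 0
partWeight (suc k) = suc (suc k)

-- A component with c vertices has part c/2 - 1; twice its weight is at most c,
-- and it weighs nothing when c ≤ 2.
double-partWeight : ∀ c → partWeight (c / 2 ∸ 1) + partWeight (c / 2 ∸ 1) ≤ c
double-partWeight c = ≤-trans (double-≤ (c / 2)) (m/n*n≤m c 2)
  where
  double-≤ : ∀ q → partWeight (q ∸ 1) + partWeight (q ∸ 1) ≤ q * 2
  double-≤ zero = z≤n
  double-≤ (suc zero) = z≤n
  double-≤ (suc (suc k)) = ≤-reflexive (double (suc (suc k)))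
    where
    double : ∀ a → a + a ≡ a * 2
    double = solve-∀

small-partWeight : ∀ c → (2 <ᵇ c) ≡ false → partWeight (c / 2 ∸ 1) ≡ 0
small-partWeight zero _ = refl
small-partWeight (suc zero) _ = refl
small-partWeight (suc (suc zero)) _ = refl
small-partWeight (suc (suc (suc c))) ()

w-cons : ∀ k ys → w (k ∷ ys) ≡ partWeight k + w ys
w-cons zero ys = refl
w-cons (suc k) ys = cong suc (shuffle (lenP ys) k (sum ys))
  where
  shuffle : ∀ a b c → a + suc (b + c) ≡ suc (b + (a + c))
  shuffle = solve-∀

w-sum : ∀ ys → w ys ≡ sum (map partWeight ys)
w-sum [] = refl
w-sum (k ∷ ys) = trans (w-cons k ys) (cong (partWeight k +_) (w-sum ys))

nonzero? : (s : ℕ) → Dec (¬ s ≡ 0)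
nonzero? s = ¬? (s ≟ℕ 0)

w-filter-nonzero : ∀ ys → w (filter nonzero? ys) ≡ w ys
w-filter-nonzero [] = refl
w-filter-nonzero (zero ∷ ys) = w-filter-nonzero ys
w-filter-nonzero (suc k ∷ ys) =
  trans (w-cons (suc k) (filter nonzero? ys)) (trans (cong (2 + k +_) (w-filter-nonzero ys)) (sym (w-cons (suc k) ys)))

w-↭ : ∀ {xs ys} → xs ↭ ys → w xs ≡ w ys
w-↭ xs↭ys = cong₂ _+_ (↭-length (filter-↭ nonzero? xs↭ys)) (sum-↭ xs↭ys)

module CosetGraph (n : ℕ) (x : Permutation′ (2 * n)) where

  open BoundedWalks (adj n x)

  X : Fin (2 * n) → Fin (2 * n)
  X i = x ⟨$⟩ʳ i

  X-injective : ∀ {a b} → X a ≡ X b → a ≡ b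
  X-injective {a} {b} Xa≡Xb = trans (sym (inverseˡ x)) (trans (cong (x ⟨$⟩ˡ_) Xa≡Xb) (inverseˡ x))

  reachN≡walk : ∀ r i j → reachN n x r i j ≡ walk r i j
  reachN≡walk zero i j = refl
  reachN≡walk (suc r) i j =
    cong₂ _∨_ (reachN≡walk r i j) (any-cong λ l → cong (_∧ adj n x l j) (reachN≡walk r i l))

  reach⇒connected : ∀ {i j} → T (reach n x i j) → Connected i j
  reach⇒connected {i} {j} h = walked (subst T (reachN≡walk (2 * n) i j) h)

  connected⇒reach : ∀ {i j} → Connected i j → T (reach n x i j)
  connected⇒reach {i} {j} c = subst T (sym (reachN≡walk (2 * n) i j)) (holds c)

  -- Γ_x is undirected: both straight and curved edges are symmetric because t is an involution.
  edge-sym : ∀ {l j} → Edge l j → Edge j l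
  edge-sym {l} {j} e with to T-∨ e
  ... | inj₁ j≡tl = from T-∨ (inj₁ (≡⇒== (t-swap (==⇒≡ {i = j} j≡tl))))
  ... | inj₂ Xj≡tXl = from T-∨ (inj₂ (≡⇒== (t-swap (==⇒≡ {i = X j} Xj≡tXl))))

  fixed-pair-edge : ∀ {l j} → X l ≡ l → X (t l) ≡ t l → Edge l j → j ≡ t l
  fixed-pair-edge {l} {j} fl ftl e with to T-∨ e
  ... | inj₁ j≡tl = ==⇒≡ j≡tl
  ... | inj₂ Xj≡tXl = X-injective (trans (==⇒≡ {i = X j} Xj≡tXl) (trans (cong t fl) (sym ftl)))

  InPair : Fin (2 * n) → Fin (2 * n) → Set
  InPair v u = u ≡ v ⊎ u ≡ t v

  fixed-pair-component : ∀ {v u} → X v ≡ v → X (t v) ≡ t v → Connected v u → InPair v u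
  fixed-pair-component {v} fv ftv = walk-invariant (InPair v) closed (2 * n) (inj₁ refl)
    where
    ttv-fixed : X (t (t v)) ≡ t (t v)
    ttv-fixed = subst (λ u → X u ≡ u) (sym (t-invol v)) fv
    closed : ∀ {l j} → InPair v l → Edge l j → InPair v j
    closed (inj₁ refl) e = inj₂ (fixed-pair-edge fv ftv e)
    closed (inj₂ refl) e = inj₁ (trans (fixed-pair-edge ftv ttv-fixed e) (t-invol v))

  compSize≡count : ∀ r → compSize n x r ≡ count (reach n x r)
  compSize≡count r = countFin≡count (reach n x r)

  rep-minimal : ∀ {r j} → T (isRep n x r) → Connected r j → toℕ r ≤ toℕ j
  rep-minimal {r} {j} rep c = ≮⇒≥ λ j<r →
    T-not (anyFin (λ k → reach n x r k ∧ ⌊ toℕ k <? toℕ r ⌋)) rep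
      (any-intro (λ k → reach n x r k ∧ ⌊ toℕ k <? toℕ r ⌋) (from T-∧ (connected⇒reach c , fromWitness j<r)))
    where
    T-not : ∀ b → T (not b) → ¬ T b
    T-not true () _
    T-not false _ ()

  rep-unique : ∀ {r r′ v} → T (isRep n x r) → T (isRep n x r′) → Connected r v → Connected r′ v → r ≡ r′
  rep-unique {r} {r′} rep rep′ c c′ = toℕ-injective (≤-antisym (rep-minimal rep r~r′) (rep-minimal rep′ r′~r))
    where
    r~r′ : Connected r r′
    r~r′ = connected-trans c (connected-sym edge-sym c′)
    r′~r : Connected r′ r
    r′~r = connected-sym edge-sym r~r′

  big : Fin (2 * n) → Bool
  big r = isRep n x r ∧ (2 <ᵇ compSize n x r)

  covers : Fin (2 * n) → Fin (2 * n) → Bool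
  covers r v = big r ∧ reach n x r v

  coverage : Fin (2 * n) → ℕ
  coverage v = count (λ r → covers r v)

  coverage≤1 : ∀ v → coverage v ≤ 1
  coverage≤1 v = count-unique (λ r → covers r v) λ a b ha hb →
    rep-unique (rep ha) (rep hb) (reach⇒connected (proj₂ (to T-∧ ha))) (reach⇒connected (proj₂ (to T-∧ hb)))
    where
    rep : ∀ {r} → T (covers r v) → T (isRep n x r)
    rep h = proj₁ (to T-∧ (proj₁ (to T-∧ h)))

  -- A pair of fixed points is a component of size two, so it is not covered.
  fixed-pair-uncovered : ∀ {v} → X v ≡ v → X (t v) ≡ t v → coverage v ≡ 0
  fixed-pair-uncovered {v} fv ftv =
    ≤-antisym (≤-trans (count-mono {q = λ _ → false} λ r h → not-covered r h) (≤-reflexive (sum-replicate-zero (2 * n)))) z≤n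
    where
    not-covered : ∀ r → T (covers r v) → ⊥
    not-covered r h with to T-∧ h
    ... | big-r , r~v with to T-∧ big-r
    ... | _ , size>2 = <⇒≱ (<ᵇ⇒< 2 (compSize n x r) size>2) (begin
      compSize n x r                       ≡⟨ compSize≡count r ⟩
      count (reach n x r)                   ≤⟨ count-cover {q = _== v} {r = _== t v} in-pair ⟩
      count (_== v) + count (_== t v)       ≡⟨ cong₂ _+_ (count-singleton v) (count-singleton (t v)) ⟩
      2                                     ∎)
      where
      open ≤-Reasoning
      in-pair : ∀ u → T (reach n x r u) → T (u == v) ⊎ T (u == t v)
      in-pair u r~u with fixed-pair-component fv ftv
                           (connected-trans (connected-sym edge-sym (reach⇒connected r~v)) (reach⇒connected r~u))
      ... | inj₁ u≡v = inj₁ (≡⇒== u≡v)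
      ... | inj₂ u≡tv = inj₂ (≡⇒== u≡tv)

  moved : Fin (2 * n) → ℕ
  moved v = ind (not (X v == v))

  moved-1 : ∀ {v} → inS n x v → moved v ≡ 1
  moved-1 v-moved = cong (ind ∘ not) (≢⇒false v-moved)

  sizeS≡∑moved : sizeS n x ≡ ∑ moved
  sizeS≡∑moved = countFin≡count (λ v → not (X v == v))

  coverage-bound : ∀ v → coverage v ≤ moved v + moved (t v)
  coverage-bound v with X v ≟ v | X (t v) ≟ t v
  ... | yes fv | yes ftv = ≤-reflexive (fixed-pair-uncovered fv ftv)
  ... | no _ | _ = ≤-trans (coverage≤1 v) (m≤m+n 1 _)
  ... | yes _ | no _ = coverage≤1 v

  pair-bound : ∀ {i} → inS n x i → inS n x (t i) → ∀ v →
    coverage v + ind (v == i) + ind (v == t i) ≤ moved v + moved (t v)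
  pair-bound {i} i-moved ti-moved v with v ≟ i | v ≟ t i
  ... | yes refl | yes v≡tv = ⊥-elim (t-no-fixed-point n v (sym v≡tv))
  ... | yes refl | no _ rewrite moved-1 i-moved | moved-1 ti-moved =
    +-monoˡ-≤ 0 (+-monoˡ-≤ 1 (coverage≤1 i))
  ... | no _ | yes refl rewrite t-invol i | moved-1 i-moved | moved-1 ti-moved =
    +-monoˡ-≤ 1 (+-monoˡ-≤ 0 (coverage≤1 (t i)))
  ... | no _ | no _ rewrite +-identityʳ (coverage v) | +-identityʳ (coverage v) = coverage-bound v

  repWeight : Fin (2 * n) → ℕ
  repWeight r = if isRep n x r then partWeight (compSize n x r / 2 ∸ 1) else 0

  coset-weight : w (cosetType n x) ≡ ∑ repWeight
  coset-weight = begin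
    w (cosetType n x)                      ≡⟨ w-↭ (↭-trans (↭-reverse _) (sort-↭ ≤-decTotalOrder nonzeroParts)) ⟩
    w nonzeroParts                         ≡⟨ w-filter-nonzero parts ⟩
    w parts                                ≡⟨ w-sum parts ⟩
    sum (map partWeight parts)             ≡⟨ cong sum (sym (map-∘ reps)) ⟩
    sum (map (partWeight ∘ part) reps)     ≡⟨ sum-filter-tabulate (isRep n x) (partWeight ∘ part) (λ r → r) ⟩
    ∑ repWeight                            ∎
    where
    open ≡-Reasoning
    part : Fin (2 * n) → ℕ
    part r = compSize n x r / 2 ∸ 1
    reps : List (Fin (2 * n))
    reps = filter (λ r → isRep n x r ≟ᵇ true) (allFin (2 * n))
    parts : List ℕ
    parts = map part reps
    nonzeroParts : List ℕ
    nonzeroParts = filter nonzero? parts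

  component-bound : ∀ r → repWeight r + repWeight r ≤ count (covers r)
  component-bound r with isRep n x r | 2 <ᵇ compSize n x r in size
  ... | false | _ = z≤n
  ... | true | true = ≤-trans (double-partWeight (compSize n x r)) (≤-reflexive (compSize≡count r))
  ... | true | false rewrite small-partWeight (compSize n x r) size = z≤n

  weight-bound : w (cosetType n x) + w (cosetType n x) ≤ ∑ coverage
  weight-bound = begin
    w (cosetType n x) + w (cosetType n x)   ≡⟨ cong₂ _+_ coset-weight coset-weight ⟩
    ∑ repWeight + ∑ repWeight               ≡⟨ ∑-distrib-+ repWeight repWeight ⟨
    ∑ (λ r → repWeight r + repWeight r)     ≤⟨ ∑-mono component-bound ⟩
    ∑ (λ r → count (covers r))              ≡⟨ ∑-comm (λ r v → ind (covers r v)) ⟩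
    ∑ coverage                              ∎
    where open ≤-Reasoning

  coverage-pair-bound : ∀ {i} → inS n x i → inS n x (t i) → ∑ coverage + 2 ≤ sizeS n x + sizeS n x
  coverage-pair-bound {i} i-moved ti-moved = begin
    ∑ coverage + 2                                       ≡⟨ +-assoc (∑ coverage) 1 1 ⟨
    ∑ coverage + 1 + 1                                   ≡⟨ cong₂ (λ a b → ∑ coverage + a + b)
                                                               (count-singleton i) (count-singleton (t i)) ⟨
    ∑ coverage + count (_== i) + count (_== t i)         ≡⟨ cong (_+ count (_== t i)) (∑-distrib-+ coverage (ind ∘ (_== i))) ⟨
    ∑ (λ v → coverage v + ind (v == i)) + count (_== t i)
                                                         ≡⟨ ∑-distrib-+ (λ v → coverage v + ind (v == i)) (ind ∘ (_== t i)) ⟨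
    ∑ (λ v → coverage v + ind (v == i) + ind (v == t i)) ≤⟨ ∑-mono (pair-bound i-moved ti-moved) ⟩
    ∑ (λ v → moved v + moved (t v))                      ≡⟨ ∑-distrib-+ moved (moved ∘ t) ⟩
    ∑ moved + ∑ (moved ∘ t)                              ≡⟨ cong (∑ moved +_) (∑-t moved) ⟩
    ∑ moved + ∑ moved                                    ≡⟨ cong₂ _+_ sizeS≡∑moved sizeS≡∑moved ⟨
    sizeS n x + sizeS n x                                ∎
    where open ≤-Reasoning

  weight<sizeS : ∀ {i} → inS n x i → inS n x (t i) → w (cosetType n x) < sizeS n x
  weight<sizeS i-moved ti-moved = halve (≤-trans (+-monoˡ-≤ 2 weight-bound) (coverage-pair-bound i-moved ti-moved))
    where
    halve : ∀ {a b} → a + a + 2 ≤ b + b → a < b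
    halve {a} 2a+2≤2b = ≰⇒> λ b≤a → m+1+n≰m (a + a) (≤-trans 2a+2≤2b (+-mono-≤ b≤a b≤a))

corollary2p14 : (n : ℕ) (x : Permutation′ (2 * n)) (μ : List ℕ) →
    cosetType n x ≡ μ → sizeS n x ≡ w μ →
    (i : Fin (2 * n)) → inS n x i → ¬ inS n x (t i)
corollary2p14 n x μ refl |S|≡wμ i i-moved ti-moved =
  <-irrefl (sym |S|≡wμ) (CosetGraph.weight<sizeS n x i-moved ti-moved)
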